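{- The Thue–Morse sequence $\mathbf{t}$ is $3$-pseudoperiodic, but not $2$-pseudoperiodic.
   Context: The Thue–Morse sequence $\mathbf{t}=01101001\cdots$ is the infinite fixed point, starting with $0$, of the morphism $0\mapsto01$, $1\mapsto10$; it is indexed from $0$. For integers $k\ge1$ and $0<p_1<\cdots<p_k$, an infinite word $\mathbf{s}$ has pseudoperiod $(p_1,\ldots,p_k)$ if $\mathbf{s}[i]\in\{\mathbf{s}[i+p_1],\ldots,\mathbf{s}[i+p_k]\}$ for all $i\ge0$; it is $k$-pseudoperiodic if it has some pseudoperiod with exactly $k$ entries. -}

module Defs where

open import Data.Nat using (ℕ; zero; suc; _<_; ⌊_/2⌋)
open import Data.Bool using (Bool; true; false; not)
open import Data.Fin using (Fin)
open import Data.Vec using (Vec; lookup)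
open import Data.Product using (Σ; ∃; _×_)
open import Relation.Binary.PropositionalEquality using (_≡_)
open import Data.Nat using (_+_)

-- Thue–Morse via the recurrence t(0)=0, t(2n)=t(n), t(2n+1)=1-t(n),
-- i.e. t(n) = parity of the binary digit sum of n (0 ↦ false, 1 ↦ true).
-- This is the fixed point of 0↦01, 1↦10 starting with 0.
-- Auxiliary with fuel: fuel ≥ n suffices.
odd? : ℕ → Bool
odd? zero = false
odd? (suc n) = not (odd? n)

tmAux : ℕ → ℕ → Bool
tmAux zero    n = false
tmAux (suc f) zero = false
tmAux (suc f) (suc n) with odd? (suc n)
... | true  = not (tmAux f ⌊ suc n /2⌋)
... | false = tmAux f ⌊ suc n /2⌋

thueMorse : ℕ → Bool
thueMorse n = tmAux n n

data Increasing : {k : ℕ} → ℕ → Vec ℕ k → Set where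
  []  : ∀ {b} → Increasing b Data.Vec.[]
  _∷_ : ∀ {k b p} {ps : Vec ℕ k} → b < p → Increasing p ps → Increasing b (p Data.Vec.∷ ps)

HasPseudoperiod : {A : Set} → (ℕ → A) → {k : ℕ} → Vec ℕ k → Set
HasPseudoperiod s {k} ps =
  Increasing 0 ps × (∀ i → Σ (Fin k) λ j → s i ≡ s (i + lookup ps j))

IsPseudoperiodic : {A : Set} → ℕ → (ℕ → A) → Set
IsPseudoperiodic k s = Σ (Vec ℕ k) λ ps → HasPseudoperiod s ps

-- Write δ a j = t (j + a) ⊕ t j.  Since t (2j + e) = e ⊕ t j, the pair (δ a, δ b) at the
-- index 2j + e is the pair (δ a′, δ b′) at j, flipped according to the parities of a and b,
-- where (a′, b′) = (⌊a/2⌋, ⌊b/2⌋) for e = 0 and (⌈a/2⌉, ⌈b/2⌉) for e = 1.  Strong induction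
-- on b along these halvings shows that for 0 < a < b all four value pairs occur, except
-- possibly (0, 0) when b = 2a.  The pair (1, 1) gives an index j with t j ≠ t (j + a) and
-- t j ≠ t (j + b), so (a, b) is not a pseudoperiod.  On the other hand t (2k + 2) ≠ t (2k + 3),
-- and for i ∈ {2k, 2k + 1} both positions lie in {i + 1, i + 2, i + 3}, so t i agrees with
-- one of them and (1, 2, 3) is a pseudoperiod.

{-# OPTIONS --safe #-}
module Submission where

open import Defs
open import Data.Bool using (Bool; true; false; not; _∧_; _xor_)
open import Data.Bool.Properties using (not-involutive; not-distribˡ-xor; not-distribʳ-xor; xor-same)
open import Data.Fin as Fin using (Fin; #_)
open import Data.Nat using (ℕ; zero; suc; _+_; _≤_; _<_; z≤n; s≤s; z<s; s<s; s≤s⁻¹; s<s⁻¹; ⌊_/2⌋)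
open import Data.Nat.Induction using (<-rec)
open import Data.Nat.Properties
  using (≤-refl; <⇒≤; suc-injective; +-comm; ≤-trans; n≤1+n; ⌊n/2⌋<n; +-suc; 1+n≢n; m+1+n≢n; m<n⇒m<1+n; n≢0⇒n>0; ≤∧≢⇒<; m≤n⇒m<n∨m≡n; _≟_)
open import Data.Product using (Σ; _×_; _,_; ∃-syntax)
open import Data.Sum using (_⊎_; inj₁; inj₂; map₂)
open import Data.Vec using ([]; _∷_; lookup)
open import Function using (_∘_)
open import Relation.Binary.PropositionalEquality using (_≡_; _≢_; refl; sym; trans; cong; cong₂; module ≡-Reasoning)
open import Relation.Nullary using (¬_; yes; no)

t : ℕ → Bool
t = thueMorse

bit : Bool → ℕ
bit false = 0
bit true  = 1

double : ℕ → ℕ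
double zero    = zero
double (suc n) = suc (suc (double n))

double-+ : ∀ m n → double (m + n) ≡ double m + double n
double-+ zero    n = refl
double-+ (suc m) n = cong (suc ∘ suc) (double-+ m n)

bit+double-+ : ∀ e r j a → (bit e + double j) + (bit r + double a) ≡ bit (e xor r) + double (j + (bit (e ∧ r) + a))
bit+double-+ false false j a = sym (double-+ j a)
bit+double-+ false true  j a = trans (+-suc (double j) (double a)) (cong suc (sym (double-+ j a)))
bit+double-+ true  false j a = cong suc (sym (double-+ j a))
bit+double-+ true  true  j a = trans (sym (+-suc (double j) (suc (double a)))) (sym (double-+ j (suc a)))

n≤double : ∀ n → n ≤ double n
n≤double zero    = z≤n
n≤double (suc n) = s≤s (≤-trans (n≤double n) (n≤1+n _))

n<double : ∀ {n} → 0 < n → n < double n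
n<double {suc n} _ = s≤s (s≤s (n≤double n))

n<bit+double : ∀ r {n} → 0 < n → n < bit r + double n
n<bit+double false 0<n = n<double 0<n
n<bit+double true  0<n = m<n⇒m<1+n (n<double 0<n)

double-cancel-≤ : ∀ {m n} → double m ≤ double n → m ≤ n
double-cancel-≤ {zero}              _             = z≤n
double-cancel-≤ {suc m} {suc n} (s≤s (s≤s 2m≤2n)) = s≤s (double-cancel-≤ 2m≤2n)

double-cancel-< : ∀ r {m n} → bit r + double m < double n → m < n
double-cancel-< false {zero}  {suc n} _                 = z<s
double-cancel-< false {suc m} {suc n} (s≤s (s≤s 2m<2n)) = s<s (double-cancel-< false 2m<2n)
double-cancel-< true                  2m+1<2n           = double-cancel-≤ 2m+1<2n

data Parity : ℕ → Set where
  bit+double : ∀ r m → Parity (bit r + double m)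

parity : ∀ n → Parity n
parity zero = bit+double false 0
parity (suc n) with parity n
... | bit+double false m = bit+double true m
... | bit+double true  m = bit+double false (suc m)

odd?-double : ∀ n → odd? (double n) ≡ false
odd?-double zero    = refl
odd?-double (suc n) = trans (not-involutive _) (odd?-double n)

odd?-bit+double : ∀ r n → odd? (bit r + double n) ≡ r
odd?-bit+double false n = odd?-double n
odd?-bit+double true  n = cong not (odd?-double n)

⌊bit+double/2⌋ : ∀ r n → ⌊ bit r + double n /2⌋ ≡ n
⌊bit+double/2⌋ false zero    = refl
⌊bit+double/2⌋ true  zero    = refl
⌊bit+double/2⌋ false (suc n) = cong suc (⌊bit+double/2⌋ false n)
⌊bit+double/2⌋ true  (suc n) = cong suc (⌊bit+double/2⌋ true n)

⌊1+n/2⌋≤n : ∀ n → ⌊ suc n /2⌋ ≤ n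
⌊1+n/2⌋≤n n = s≤s⁻¹ (⌊n/2⌋<n n)

tmAux-fuel : ∀ {f g n} → n ≤ f → n ≤ g → tmAux f n ≡ tmAux g n
tmAux-fuel {zero}  {zero}  z≤n z≤n = refl
tmAux-fuel {zero}  {suc g} z≤n z≤n = refl
tmAux-fuel {suc f} {zero}  z≤n z≤n = refl
tmAux-fuel {suc f} {suc g} z≤n z≤n = refl
tmAux-fuel {suc f} {suc g} {suc n} (s≤s n≤f) (s≤s n≤g) with odd? (suc n)
... | true  = cong not (tmAux-fuel (≤-trans (⌊1+n/2⌋≤n n) n≤f) (≤-trans (⌊1+n/2⌋≤n n) n≤g))
... | false = tmAux-fuel (≤-trans (⌊1+n/2⌋≤n n) n≤f) (≤-trans (⌊1+n/2⌋≤n n) n≤g)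

thueMorse-half : ∀ n → t n ≡ odd? n xor t ⌊ n /2⌋
thueMorse-half zero = refl
thueMorse-half (suc n) with odd? (suc n)
... | true  = cong not (tmAux-fuel (⌊1+n/2⌋≤n n) ≤-refl)
... | false = tmAux-fuel (⌊1+n/2⌋≤n n) ≤-refl

thueMorse-bit+double : ∀ r n → t (bit r + double n) ≡ r xor t n
thueMorse-bit+double r n =
  trans (thueMorse-half (bit r + double n))
        (cong₂ _xor_ (odd?-bit+double r n) (cong t (⌊bit+double/2⌋ r n)))

thueMorse-odd-after-even : ∀ n → t (suc (double n)) ≡ not (t (double n))
thueMorse-odd-after-even n =
  trans (thueMorse-bit+double true n) (cong not (sym (thueMorse-bit+double false n)))

xor-cancelˡ : ∀ r x → r xor (r xor x) ≡ x
xor-cancelˡ false x = refl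
xor-cancelˡ true  x = not-involutive x

xor-shuffle : ∀ e r u v → ((e xor r) xor u) xor (e xor v) ≡ r xor (u xor v)
xor-shuffle false false u v = refl
xor-shuffle false true  u v = sym (not-distribˡ-xor u v)
xor-shuffle true  false u v = trans (sym (not-distribˡ-xor u (not v)))
                                    (trans (cong not (sym (not-distribʳ-xor u v))) (not-involutive _))
xor-shuffle true  true  u v = sym (not-distribʳ-xor u v)

δ : ℕ → ℕ → Bool
δ a j = t (j + a) xor t j

δ-bit+double : ∀ e r a j → δ (bit r + double a) (bit e + double j) ≡ r xor δ (bit (e ∧ r) + a) j
δ-bit+double e r a j = begin
    t ((bit e + double j) + (bit r + double a)) xor t (bit e + double j)
  ≡⟨ cong₂ _xor_ (cong t (bit+double-+ e r j a)) refl ⟩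
    t (bit (e xor r) + double (j + a′)) xor t (bit e + double j)
  ≡⟨ cong₂ _xor_ (thueMorse-bit+double (e xor r) (j + a′)) (thueMorse-bit+double e j) ⟩
    ((e xor r) xor t (j + a′)) xor (e xor t j)
  ≡⟨ xor-shuffle e r (t (j + a′)) (t j) ⟩
    r xor δ a′ j
  ∎
  where
  open ≡-Reasoning
  a′ = bit (e ∧ r) + a

Realised : ℕ → ℕ → Bool → Bool → Set
Realised a b x y = ∃[ j ] δ a j ≡ x × δ b j ≡ y

realised-halve : ∀ e ra rb {a b x y}
  → Realised (bit (e ∧ ra) + a) (bit (e ∧ rb) + b) (ra xor x) (rb xor y)
  → Realised (bit ra + double a) (bit rb + double b) x y
realised-halve e ra rb {a} {b} {x} {y} (j , δa≡ , δb≡) =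
  bit e + double j , unflip ra a x δa≡ , unflip rb b y δb≡
  where
  unflip : ∀ r c z → δ (bit (e ∧ r) + c) j ≡ r xor z → δ (bit r + double c) (bit e + double j) ≡ z
  unflip r c z δ≡ = trans (δ-bit+double e r c j) (trans (cong (r xor_) δ≡) (xor-cancelˡ r z))

realised-zero : ∀ n → 0 < n → ∀ y → Realised 0 n false y
realised-zero = <-rec _ step
  where
  step : ∀ n → (∀ {m} → m < n → 0 < m → ∀ y → Realised 0 m false y) → 0 < n → ∀ y → Realised 0 n false y
  step n ih 0<n y with parity n
  step _ ih ()  y     | bit+double false zero
  step _ ih _   true  | bit+double true  zero = 0 , refl , refl
  step _ ih _   false | bit+double true  zero = 1 , refl , refl
  step _ ih _   y     | bit+double r (suc m)  = realised-halve false false r (ih (n<bit+double r z<s) z<s (r xor y))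

realised-diagonal : ∀ {n x} → Realised 0 n false x → Realised n n x x
realised-diagonal (j , _ , δ≡) = j , δ≡ , δ≡

record AllPatterns (a b : ℕ) : Set where
  constructor patterns
  field
    ft : Realised a b false true
    tf : Realised a b true false
    tt : Realised a b true true
    -- For a = 1, b = 2 this pattern would be a factor 000 or 111 of t.
    ff : b ≢ double a → Realised a b false false

open AllPatterns

even-even : ∀ {a b} → AllPatterns a b → AllPatterns (double a) (double b)
even-even P = patterns (low (ft P)) (low (tf P)) (low (tt P)) (λ b≢2a → low (ff P (b≢2a ∘ cong double)))
  where low = realised-halve false false false

odd-odd : ∀ {a b} → AllPatterns (suc a) (suc b) → (suc b ≡ double (suc a) → Realised a b false false)
        → AllPatterns (suc (double a)) (suc (double b))
odd-odd {a} {b} P ff-below = patterns (high (tf P)) (high (ft P)) tt′ (λ _ → high (tt P))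
  where
  low  = realised-halve false true true
  high = realised-halve true true true
  tt′ : Realised (suc (double a)) (suc (double b)) true true
  tt′ with suc b ≟ double (suc a)
  ... | yes b≡2a = low (ff-below b≡2a)
  ... | no  b≢2a = high (ff P b≢2a)

even-odd : ∀ {a b} → AllPatterns a (suc b) → (suc b ≡ double a → Realised a b false false)
         → AllPatterns (double a) (suc (double b))
even-odd {a} {b} P ff-below = patterns ft′ (high (tt P)) (high (tf P)) (λ _ → high (ft P))
  where
  low  = realised-halve false false true
  high = realised-halve true false true
  ft′ : Realised (double a) (suc (double b)) false true
  ft′ with suc b ≟ double a
  ... | yes b≡2a = low (ff-below b≡2a)
  ... | no  b≢2a = high (ff P b≢2a)

odd-even : ∀ {a b} → AllPatterns a b → (b ≡ double a → Realised (suc a) b false false)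
         → AllPatterns (suc (double a)) (double b)
odd-even {a} {b} P ff-above = patterns (low (tt P)) tf′ (low (ft P)) (λ _ → low (tf P))
  where
  low  = realised-halve false true false
  high = realised-halve true true false
  tf′ : Realised (suc (double a)) (double b) true false
  tf′ with b ≟ double a
  ... | yes b≡2a = high (ff-above b≡2a)
  ... | no  b≢2a = low (ff P b≢2a)

one-even : ∀ {b} → (∀ y → Realised 0 b false y) → Realised 1 b true true → (b ≢ 1 → Realised 1 b true false)
         → AllPatterns 1 (double b)
one-even zero-b tt-b tf-b =
  patterns (high tt-b) (low (zero-b false)) (low (zero-b true)) (λ b≢2 → high (tf-b (b≢2 ∘ cong double)))
  where
  low  = realised-halve false true false
  high = realised-halve true true false

ff-realised : ∀ {a c} → (∀ {a} → 0 < a → a < c → AllPatterns a c) → a ≤ c → c ≢ double a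
            → Realised a c false false
ff-realised {zero}  _   _   c≢0 = realised-zero _ (n≢0⇒n>0 c≢0) false
ff-realised {suc a} all a≤c c≢2a with m≤n⇒m<n∨m≡n a≤c
... | inj₁ a<c  = ff (all z<s a<c) c≢2a
... | inj₂ refl = realised-diagonal (realised-zero _ z<s false)

tt-realised : ∀ {a c} → (∀ {a} → 0 < a → a < c → AllPatterns a c) → 0 < a → a ≤ c → Realised a c true true
tt-realised all 0<a a≤c with m≤n⇒m<n∨m≡n a≤c
... | inj₁ a<c  = tt (all 0<a a<c)
... | inj₂ refl = realised-diagonal (realised-zero _ 0<a true)

allPatterns : ∀ b {a} → 0 < a → a < b → AllPatterns a b
allPatterns = <-rec _ step
  where
  step : ∀ b → (∀ {c} → c < b → ∀ {a} → 0 < a → a < c → AllPatterns a c)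
       → ∀ {a} → 0 < a → a < b → AllPatterns a b
  step b ih {a} 0<a a<b with parity a | parity b
  ... | bit+double false a′ | bit+double false b′ =
    even-even (ih (n<double 0<b′) 0<a′ a′<b′)
    where
    0<a′  = double-cancel-< false 0<a
    a′<b′ = double-cancel-< false a<b
    0<b′  = ≤-trans 0<a′ (<⇒≤ a′<b′)
  ... | bit+double true a′ | bit+double true b′ =
    odd-odd (ih (s<s (n<double 0<b′)) z<s (s<s a′<b′))
            (λ b≡2a → ff-realised (ih (m<n⇒m<1+n (n<double 0<b′))) (<⇒≤ a′<b′)
                                  (λ b′≡ → 1+n≢n (trans (sym (suc-injective b≡2a)) b′≡)))
    where
    a′<b′ = double-cancel-< false (s<s⁻¹ a<b)
    0<b′  = ≤-trans (s≤s z≤n) a′<b′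
  ... | bit+double false a′ | bit+double true b′ =
    even-odd (ih (s<s (n<double 0<b′)) 0<a′ (s≤s a′≤b′))
             (λ b≡2a → ff-realised (ih (m<n⇒m<1+n (n<double 0<b′))) a′≤b′
                                   (λ b′≡ → 1+n≢n (trans b≡2a (sym b′≡))))
    where
    0<a′  = double-cancel-< false 0<a
    a′≤b′ = double-cancel-≤ (s≤s⁻¹ a<b)
    0<b′  = ≤-trans 0<a′ a′≤b′
  ... | bit+double true zero | bit+double false b′ =
    one-even (realised-zero b′ 0<b′) (tt-realised (ih b′<b) z<s 0<b′)
             (λ b′≢1 → tf (ih b′<b z<s (≤∧≢⇒< 0<b′ (b′≢1 ∘ sym))))
    where
    0<b′ = double-cancel-< true a<b
    b′<b = n<double 0<b′
  ... | bit+double true a′@(suc _) | bit+double false b′ =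
    odd-even (ih b′<b z<s a′<b′)
             (λ b≡2a → ff-realised (ih b′<b) a′<b′ (λ b′≡ → m+1+n≢n 1 (sym (trans (sym b≡2a) b′≡))))
    where
    a′<b′ = double-cancel-< true a<b
    b′<b  = n<double (≤-trans (s≤s z≤n) a′<b′)

≡⊎≡not : ∀ u v → u ≡ v ⊎ u ≡ not v
≡⊎≡not false false = inj₁ refl
≡⊎≡not false true  = inj₂ refl
≡⊎≡not true  false = inj₂ refl
≡⊎≡not true  true  = inj₁ refl

≡-next-pair : ∀ u k → u ≡ t (double (suc k)) ⊎ u ≡ t (suc (double (suc k)))
≡-next-pair u k with ≡⊎≡not u (t (double (suc k)))
... | inj₁ u≡ = inj₁ u≡
... | inj₂ u≡ = inj₂ (trans u≡ (sym (thueMorse-odd-after-even (suc k))))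

thueMorse-ahead : ∀ i → t i ≡ t (i + 1) ⊎ t i ≡ t (i + 2) ⊎ t i ≡ t (i + 3)
thueMorse-ahead i with parity i
... | bit+double false k rewrite +-comm (double k) 2 | +-comm (double k) 3 = inj₂ (≡-next-pair _ k)
... | bit+double true  k rewrite +-comm (double k) 1 | +-comm (double k) 2 = map₂ inj₁ (≡-next-pair _ k)

pseudoperiod-123 : HasPseudoperiod t (1 ∷ 2 ∷ 3 ∷ [])
pseudoperiod-123 = (s≤s z≤n ∷ s≤s (s≤s z≤n) ∷ s≤s (s≤s (s≤s z≤n)) ∷ []) , offset
  where
  offset : ∀ i → Σ (Fin 3) λ j → t i ≡ t (i + lookup (1 ∷ 2 ∷ 3 ∷ []) j)
  offset i with thueMorse-ahead i
  ... | inj₁ t≡         = # 0 , t≡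
  ... | inj₂ (inj₁ t≡) = # 1 , t≡
  ... | inj₂ (inj₂ t≡) = # 2 , t≡

δ≡true⇒≢ : ∀ a j → δ a j ≡ true → t j ≢ t (j + a)
δ≡true⇒≢ a j δ≡ t≡ with trans (sym δ≡) (trans (cong (_xor t j) (sym t≡)) (xor-same (t j)))
... | ()

not-2-pseudoperiodic : ¬ IsPseudoperiodic 2 t
not-2-pseudoperiodic ((p ∷ q ∷ []) , (0<p ∷ p<q ∷ []) , period) with tt (allPatterns q 0<p p<q)
... | j , δp≡ , δq≡ with period j
...   | Fin.zero       , t≡ = δ≡true⇒≢ p j δp≡ t≡
...   | Fin.suc Fin.zero , t≡ = δ≡true⇒≢ q j δq≡ t≡

proposition11 : IsPseudoperiodic 3 thueMorse × ¬ IsPseudoperiodic 2 thueMorse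
proposition11 = ((1 ∷ 2 ∷ 3 ∷ []) , pseudoperiod-123) , not-2-pseudoperiodic
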